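{- Let $\mathcal{S}=(a_{n,m})_{n,m\geq 0}$ be an infinite matrix of complex numbers satisfying $a_{n+1,m}=a_{n,m+1}+m\,a_{n,m}$ for all $n,m\geq 0$, and write $a_m=a_{0,m}$ and $b_n=a_{n,0}$. Then for all $n,m\geq 0$, $$\sum_{k=0}^{m}s(m,k)\,b_{n+k}=\sum_{k=0}^{n}\genfrac{\{}{\}}{0pt}{}{n+m}{k+m}_{m}a_{m+k}.$$
   Context: $s(n,k)$ denotes the signed Stirling numbers of the first kind, defined by $x(x-1)\cdots(x-n+1)=\sum_{k=0}^{n}s(n,k)x^k$, with $s(n,k)=0$ for $k>n$ or $k<0$. For an integer $r\geq 0$, the $r$-Stirling numbers of the second kind $\genfrac{\{}{\}}{0pt}{}{n}{k}_{r}$ are defined by: $\genfrac{\{}{\}}{0pt}{}{n}{k}_{r}=0$ for $n<r$; $\genfrac{\{}{\}}{0pt}{}{n}{k}_{r}=\delta_{k,r}$ for $n=r$; and $\genfrac{\{}{\}}{0pt}{}{n}{k}_{r}=k\genfrac{\{}{\}}{0pt}{}{n-1}{k}_{r}+\genfrac{\{}{\}}{0pt}{}{n-1}{k-1}_{r}$ for $n>r$. -}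

module Defs where

open import Level using (Level)
open import Data.Bool using (Bool; true; false; if_then_else_)
open import Data.Nat as ℕ using (ℕ; zero; suc; _<ᵇ_; _≡ᵇ_)
open import Data.Integer as ℤ using (ℤ; +_; -[1+_])
open import Algebra.Bundles using (CommutativeRing)

-- Signed Stirling numbers of the first kind s(n,k):
-- coefficients of x(x-1)...(x-n+1) = Σ_k s(n,k) x^k, i.e. written out via
-- x(x-1)...(x-n) = (x - n) · x(x-1)...(x-n+1):
--   s(0,0)=1, s(0,k+1)=0, s(n+1,0) = -n s(n,0), s(n+1,k+1) = s(n,k) - n s(n,k+1).
stirling1 : ℕ → ℕ → ℤ
stirling1 zero    zero    = ℤ.+ 1
stirling1 zero    (suc k) = ℤ.+ 0
stirling1 (suc n) zero    = ℤ.- ((ℤ.+ n) ℤ.* stirling1 n zero)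
stirling1 (suc n) (suc k) = stirling1 n k ℤ.- ((ℤ.+ n) ℤ.* stirling1 n (suc k))

δ : ℕ → ℕ → ℕ
δ i j = if i ≡ᵇ j then 1 else 0

rStirling2 : ℕ → ℕ → ℕ → ℕ
rStirling2 r zero k = if 0 <ᵇ r then 0 else δ k r
rStirling2 r (suc n) k with suc n <ᵇ r | suc n ≡ᵇ r
... | true  | _     = 0
... | false | true  = δ k r
... | false | false = k ℕ.* rStirling2 r n k ℕ.+ prev k
  where
  prev : ℕ → ℕ
  prev zero     = 0
  prev (suc k') = rStirling2 r n k'

module _ {c ℓ : Level} (R : CommutativeRing c ℓ) where
  open CommutativeRing R

  _·ℕ_ : ℕ → Carrier → Carrier
  zero  ·ℕ x = 0#
  suc n ·ℕ x = x + (n ·ℕ x)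

  _·ℤ_ : ℤ → Carrier → Carrier
  (+ n)      ·ℤ x = n ·ℕ x
  (-[1+ n ]) ·ℤ x = - (suc n ·ℕ x)

  sumTo : ℕ → (ℕ → Carrier) → Carrier
  sumTo zero    f = f 0
  sumTo (suc n) f = sumTo n f + f (suc n)

-- Both sides equal the matrix entry a(n,m). For the left side, induct on m: the
-- recursion s(m+1,k+1) = s(m,k) - m s(m,k+1) turns the m+1 sum into the m sum taken
-- along row n+1 minus m times the m sum along row n, i.e. a(n+1,m) - m a(n,m), which is
-- a(n,m+1) by the matrix recursion. For the right side, unfold a(p+n,m) one row at a
-- time: after n steps it is a combination of a(p,m+k), k ≤ n, whose coefficients obey
-- exactly the recursion of {n+m, k+m}_m.
module Submission where

open import Defs
open import Data.Nat using (ℕ; zero; suc; _+_; _*_; _<_; _<ᵇ_; _≡ᵇ_; s≤s)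
open import Algebra.Bundles using (CommutativeRing)
open import Data.Bool using (true; false)
import Data.Nat.Properties as ℕ
open import Data.Integer as ℤ using (ℤ; +_; -[1+_]; _⊖_)
open import Data.Integer.Properties using ([1+m]⊖[1+n]≡m⊖n; suc-*; *-zeroˡ; *-zeroʳ)
import Relation.Binary.PropositionalEquality as ≡
open ≡ using (_≡_)

m+n<ᵇn≡false : ∀ m n → (m + n <ᵇ n) ≡ false
m+n<ᵇn≡false m zero    = ≡.refl
m+n<ᵇn≡false m (suc n) rewrite ℕ.+-suc m n = m+n<ᵇn≡false m n

1+m+n≡ᵇn≡false : ∀ m n → (suc m + n ≡ᵇ n) ≡ false
1+m+n≡ᵇn≡false m zero    = ≡.refl
1+m+n≡ᵇn≡false m (suc n) rewrite ℕ.+-suc m n = 1+m+n≡ᵇn≡false m n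

n≡ᵇn≡true : ∀ n → (n ≡ᵇ n) ≡ true
n≡ᵇn≡true zero    = ≡.refl
n≡ᵇn≡true (suc n) = n≡ᵇn≡true n

δ-diag : ∀ n → δ n n ≡ 1
δ-diag n rewrite n≡ᵇn≡true n = ≡.refl

δ-above : ∀ m n → δ (suc m + n) n ≡ 0
δ-above m n rewrite 1+m+n≡ᵇn≡false m n = ≡.refl

rStirling2-diag : ∀ r k → rStirling2 r r k ≡ δ k r
rStirling2-diag zero    k = ≡.refl
rStirling2-diag (suc r) k rewrite m+n<ᵇn≡false 0 r | n≡ᵇn≡true r = ≡.refl

rStirling2-suc : ∀ r n k → rStirling2 r (suc (n + r)) (suc k)
                            ≡ suc k * rStirling2 r (n + r) (suc k) + rStirling2 r (n + r) k
rStirling2-suc r n k rewrite m+n<ᵇn≡false (suc n) r | 1+m+n≡ᵇn≡false n r = ≡.refl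

rStirling2-below : ∀ r n k → k < r → rStirling2 r n k ≡ 0
rStirling2-below (suc r) zero    k       k<r = ≡.refl
rStirling2-below r       (suc n) k       k<r with suc n <ᵇ r | suc n ≡ᵇ r
... | true  | _    = ≡.refl
... | false | true = δ-below k r k<r
  where
  δ-below : ∀ k r → k < r → δ k r ≡ 0
  δ-below zero    (suc r) _         = ≡.refl
  δ-below (suc k) (suc r) (s≤s k<r) = δ-below k r k<r
rStirling2-below r (suc n) zero    k<r | false | false = ≡.refl
rStirling2-below r (suc n) (suc k) k<r | false | false
  rewrite rStirling2-below r n (suc k) k<r | rStirling2-below r n k (ℕ.<-trans (ℕ.n<1+n k) k<r)
        | ℕ.*-zeroʳ k = ≡.refl

rStirling2-suc-diag : ∀ r n → rStirling2 r (suc (n + r)) r ≡ r * rStirling2 r (n + r) r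
rStirling2-suc-diag zero    n = ≡.refl
rStirling2-suc-diag (suc r) n
  rewrite rStirling2-suc (suc r) n r | rStirling2-below (suc r) (n + suc r) r (ℕ.n<1+n r) =
  ℕ.+-comm _ 0

-- {n+r, k+r}_r, re-indexed so that the boundary cases of rStirling2 disappear.
shiftedRStirling2 : ℕ → ℕ → ℕ → ℕ
shiftedRStirling2 r zero    zero    = 1
shiftedRStirling2 r zero    (suc k) = 0
shiftedRStirling2 r (suc n) zero    = r * shiftedRStirling2 r n zero
shiftedRStirling2 r (suc n) (suc k) =
  (suc k + r) * shiftedRStirling2 r n (suc k) + shiftedRStirling2 r n k

shiftedRStirling2-above : ∀ r n k → n < k → shiftedRStirling2 r n k ≡ 0
shiftedRStirling2-above r zero    (suc k) _ = ≡.refl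
shiftedRStirling2-above r (suc n) (suc k) (s≤s n<k)
  rewrite shiftedRStirling2-above r n (suc k) (ℕ.<-trans n<k (ℕ.n<1+n k))
        | shiftedRStirling2-above r n k n<k
        | ℕ.*-comm (suc k + r) 0 = ≡.refl

rStirling2≡shiftedRStirling2 : ∀ r n k → rStirling2 r (n + r) (k + r) ≡ shiftedRStirling2 r n k
rStirling2≡shiftedRStirling2 r zero    zero    = ≡.trans (rStirling2-diag r r) (δ-diag r)
rStirling2≡shiftedRStirling2 r zero    (suc k) = ≡.trans (rStirling2-diag r (suc k + r)) (δ-above k r)
rStirling2≡shiftedRStirling2 r (suc n) zero
  rewrite rStirling2-suc-diag r n | rStirling2≡shiftedRStirling2 r n zero = ≡.refl
rStirling2≡shiftedRStirling2 r (suc n) (suc k)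
  rewrite rStirling2-suc r n (k + r)
        | rStirling2≡shiftedRStirling2 r n (suc k) | rStirling2≡shiftedRStirling2 r n k = ≡.refl

stirling1-above : ∀ m k → m < k → stirling1 m k ≡ + 0
stirling1-above zero    (suc k) _ = ≡.refl
stirling1-above (suc m) (suc k) (s≤s m<k)
  rewrite stirling1-above m k m<k | stirling1-above m (suc k) (ℕ.<-trans m<k (ℕ.n<1+n k))
        | *-zeroʳ (+ m) = ≡.refl

module _ {a ℓ} (R : CommutativeRing a ℓ) where
  open CommutativeRing R renaming (_+_ to _⊕_) hiding (_*_)
  open import Algebra.Properties.CommutativeMonoid.Mult +-commutativeMonoid
    using (_×_; ×-congʳ; ×-congˡ; ×-homo-+; ×-assocˡ; ×-distrib-+)
  open import Algebra.Properties.CommutativeSemigroup +-commutativeSemigroup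
    using (interchange; x∙yz≈y∙xz)
  open import Algebra.Properties.Ring ring
    using (-0#≈0#; -‿involutive; -‿+-comm; //-rightDividesʳ)
  open import Relation.Binary.Reasoning.Setoid setoid

  infixr 8 _·_
  _·_ : ℤ → Carrier → Carrier
  _·_ = _·ℤ_ R

  Σ : ℕ → (ℕ → Carrier) → Carrier
  Σ = sumTo R

  ·ℕ≡× : ∀ n x → _·ℕ_ R n x ≡ n × x
  ·ℕ≡× zero    x = ≡.refl
  ·ℕ≡× (suc n) x = ≡.cong (x ⊕_) (·ℕ≡× n x)

  ·-homo-⊖ : ∀ a b x → (a ⊖ b) · x ≈ a × x - b × x
  ·-homo-⊖ a       zero    x = begin
    (a ⊖ 0) · x   ≡⟨ ·ℕ≡× a x ⟩
    a × x         ≈⟨ +-identityʳ (a × x) ⟨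
    a × x ⊕ 0#    ≈⟨ +-congˡ -0#≈0# ⟨
    a × x - 0 × x ∎
  ·-homo-⊖ zero    (suc b) x = begin
    (0 ⊖ suc b) · x    ≡⟨ ≡.cong -_ (·ℕ≡× (suc b) x) ⟩
    - (suc b × x)      ≈⟨ +-identityˡ _ ⟨
    0 × x - suc b × x  ∎
  ·-homo-⊖ (suc a) (suc b) x = begin
    (suc a ⊖ suc b) · x                 ≡⟨ ≡.cong (_· x) ([1+m]⊖[1+n]≡m⊖n a b) ⟩
    (a ⊖ b) · x                         ≈⟨ ·-homo-⊖ a b x ⟩
    a × x - b × x                       ≈⟨ +-identityˡ _ ⟨
    0# ⊕ (a × x - b × x)                ≈⟨ +-congʳ (-‿inverseʳ x) ⟨
    (x - x) ⊕ (a × x - b × x)           ≈⟨ interchange x (- x) (a × x) (- (b × x)) ⟩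
    (x ⊕ a × x) ⊕ (- x ⊕ - (b × x))     ≈⟨ +-congˡ (-‿+-comm x (b × x)) ⟩
    suc a × x - suc b × x               ∎

  +·≈× : ∀ n x → (+ n) · x ≈ n × x
  +·≈× n x = reflexive (·ℕ≡× n x)

  -[1+]·≈-× : ∀ n x → -[1+ n ] · x ≈ - (suc n × x)
  -[1+]·≈-× n x = -‿cong (+·≈× (suc n) x)

  ·-homo-+ : ∀ i j x → (i ℤ.+ j) · x ≈ i · x ⊕ j · x
  ·-homo-+ (+ a)    (+ b)    x = begin
    (+ (a + b)) · x       ≈⟨ +·≈× (a + b) x ⟩
    (a + b) × x           ≈⟨ ×-homo-+ x a b ⟩
    a × x ⊕ b × x         ≈⟨ +-cong (+·≈× a x) (+·≈× b x) ⟨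
    (+ a) · x ⊕ (+ b) · x ∎
  ·-homo-+ (+ a)    -[1+ b ] x =
    trans (·-homo-⊖ a (suc b) x) (+-cong (sym (+·≈× a x)) (sym (-[1+]·≈-× b x)))
  ·-homo-+ -[1+ a ] (+ b)    x =
    trans (·-homo-⊖ b (suc a) x) (trans (+-comm _ _) (+-cong (sym (-[1+]·≈-× a x)) (sym (+·≈× b x))))
  ·-homo-+ -[1+ a ] -[1+ b ] x = begin
    -[1+ suc (a + b) ] · x               ≈⟨ -[1+]·≈-× (suc (a + b)) x ⟩
    - (suc (suc (a + b)) × x)            ≡⟨ ≡.cong (λ n → - (suc n × x)) (≡.sym (ℕ.+-suc a b)) ⟩
    - ((suc a + suc b) × x)              ≈⟨ -‿cong (×-homo-+ x (suc a) (suc b)) ⟩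
    - (suc a × x ⊕ suc b × x)            ≈⟨ -‿+-comm (suc a × x) (suc b × x) ⟨
    - (suc a × x) ⊕ - (suc b × x)        ≈⟨ +-cong (-[1+]·≈-× a x) (-[1+]·≈-× b x) ⟨
    -[1+ a ] · x ⊕ -[1+ b ] · x          ∎

  ·-homo-neg : ∀ i x → (ℤ.- i) · x ≈ - (i · x)
  ·-homo-neg (+ zero)  x = sym -0#≈0#
  ·-homo-neg (+ suc n) x = refl
  ·-homo-neg -[1+ n ]  x = sym (-‿involutive _)

  ·-assoc-× : ∀ n i x → (+ n ℤ.* i) · x ≈ n × (i · x)
  ·-assoc-× zero    i x = reflexive (≡.cong (_· x) (*-zeroˡ i))
  ·-assoc-× (suc n) i x = begin
    (+ suc n ℤ.* i) · x          ≡⟨ ≡.cong (_· x) (suc-* (+ n) i) ⟩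
    (i ℤ.+ + n ℤ.* i) · x        ≈⟨ ·-homo-+ i (+ n ℤ.* i) x ⟩
    i · x ⊕ (+ n ℤ.* i) · x      ≈⟨ +-congˡ (·-assoc-× n i x) ⟩
    suc n × (i · x)              ∎

  ·-homo-neg-× : ∀ m i x → (ℤ.- (+ m ℤ.* i)) · x ≈ - (m × (i · x))
  ·-homo-neg-× m i x = trans (·-homo-neg (+ m ℤ.* i) x) (-‿cong (·-assoc-× m i x))

  stirling1-suc-zero-· : ∀ m x → stirling1 (suc m) 0 · x ≈ - (m × (stirling1 m 0 · x))
  stirling1-suc-zero-· m = ·-homo-neg-× m (stirling1 m 0)

  stirling1-suc-suc-· : ∀ m k x →
    stirling1 (suc m) (suc k) · x ≈ stirling1 m k · x - m × (stirling1 m (suc k) · x)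
  stirling1-suc-suc-· m k x =
    trans (·-homo-+ (stirling1 m k) _ x) (+-congˡ (·-homo-neg-× m (stirling1 m (suc k)) x))

  Σ-cong : ∀ n {f g : ℕ → Carrier} → (∀ k → f k ≈ g k) → Σ n f ≈ Σ n g
  Σ-cong zero    f≈g = f≈g 0
  Σ-cong (suc n) f≈g = +-cong (Σ-cong n f≈g) (f≈g (suc n))

  Σ-uncons : ∀ n f → Σ (suc n) f ≈ f 0 ⊕ Σ n (λ k → f (suc k))
  Σ-uncons zero    f = refl
  Σ-uncons (suc n) f = trans (+-congʳ (Σ-uncons n f)) (+-assoc _ _ _)

  Σ-drop-last : ∀ n f → f (suc n) ≈ 0# → Σ (suc n) f ≈ Σ n f
  Σ-drop-last n f fn≈0 = trans (+-congˡ fn≈0) (+-identityʳ (Σ n f))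

  Σ-distrib-⊕ : ∀ n f g → Σ n (λ k → f k ⊕ g k) ≈ Σ n f ⊕ Σ n g
  Σ-distrib-⊕ zero    f g = refl
  Σ-distrib-⊕ (suc n) f g = trans (+-congʳ (Σ-distrib-⊕ n f g)) (interchange _ _ _ _)

  Σ-distrib-neg : ∀ n f → Σ n (λ k → - f k) ≈ - Σ n f
  Σ-distrib-neg zero    f = refl
  Σ-distrib-neg (suc n) f = trans (+-congʳ (Σ-distrib-neg n f)) (-‿+-comm _ _)

  Σ-distrib-- : ∀ n f g → Σ n (λ k → f k - g k) ≈ Σ n f - Σ n g
  Σ-distrib-- n f g = trans (Σ-distrib-⊕ n f (λ k → - g k)) (+-congˡ (Σ-distrib-neg n g))

  Σ-distrib-× : ∀ n a f → Σ n (λ k → a × f k) ≈ a × Σ n f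
  Σ-distrib-× zero    a f = refl
  Σ-distrib-× (suc n) a f = trans (+-congʳ (Σ-distrib-× n a f)) (sym (×-distrib-+ (Σ n f) (f (suc n)) a))

  Σ-stirling1-suc : ∀ m (f : ℕ → Carrier) →
    Σ (suc m) (λ k → stirling1 (suc m) k · f k)
      ≈ Σ m (λ k → stirling1 m k · f (suc k)) - m × Σ m (λ k → stirling1 m k · f k)
  Σ-stirling1-suc m f = begin
    Σ (suc m) (λ k → stirling1 (suc m) k · f k)
      ≈⟨ Σ-uncons m _ ⟩
    stirling1 (suc m) 0 · f 0 ⊕ Σ m (λ k → stirling1 (suc m) (suc k) · f (suc k))
      ≈⟨ +-cong (stirling1-suc-zero-· m (f 0)) (Σ-cong m (λ k → stirling1-suc-suc-· m k (f (suc k)))) ⟩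
    - (m × head) ⊕ Σ m (λ k → shifted k - m × tail k)
      ≈⟨ +-congˡ (trans (Σ-distrib-- m shifted _) (+-congˡ (-‿cong (Σ-distrib-× m m tail)))) ⟩
    - (m × head) ⊕ (Σ m shifted - m × Σ m tail)
      ≈⟨ x∙yz≈y∙xz _ _ _ ⟩
    Σ m shifted ⊕ (- (m × head) - m × Σ m tail)
      ≈⟨ +-congˡ (-‿+-comm _ _) ⟩
    Σ m shifted - (m × head ⊕ m × Σ m tail)
      ≈⟨ +-congˡ (-‿cong (×-distrib-+ head (Σ m tail) m)) ⟨
    Σ m shifted - m × (head ⊕ Σ m tail)
      ≈⟨ +-congˡ (-‿cong (×-congʳ m unshifted)) ⟩
    Σ m shifted - m × Σ m (λ k → stirling1 m k · f k)
      ∎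
    where
    shifted tail : ℕ → Carrier
    shifted k = stirling1 m k · f (suc k)
    tail    k = stirling1 m (suc k) · f (suc k)
    head : Carrier
    head = stirling1 m 0 · f 0
    unshifted : head ⊕ Σ m tail ≈ Σ m (λ k → stirling1 m k · f k)
    unshifted = trans (sym (Σ-uncons m _))
      (Σ-drop-last m _ (reflexive (≡.cong (_· f (suc m)) (stirling1-above m (suc m) (ℕ.n<1+n m)))))

  Σ-shiftedRStirling2-suc : ∀ r n (g : ℕ → Carrier) →
    Σ n (λ k → shiftedRStirling2 r n k × (g (suc k) ⊕ (k + r) × g k))
      ≈ Σ (suc n) (λ k → shiftedRStirling2 r (suc n) k × g k)
  Σ-shiftedRStirling2-suc r n g = begin
    Σ n (λ k → c k × (g (suc k) ⊕ (k + r) × g k))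
      ≈⟨ Σ-cong n split ⟩
    Σ n (λ k → raised k ⊕ kept k)
      ≈⟨ Σ-distrib-⊕ n raised kept ⟩
    Σ n raised ⊕ Σ n kept
      ≈⟨ +-congˡ (Σ-drop-last n kept last-vanishes) ⟨
    Σ n raised ⊕ Σ (suc n) kept
      ≈⟨ +-congˡ (Σ-uncons n kept) ⟩
    Σ n raised ⊕ (kept 0 ⊕ Σ n (λ k → kept (suc k)))
      ≈⟨ x∙yz≈y∙xz _ _ _ ⟩
    kept 0 ⊕ (Σ n raised ⊕ Σ n (λ k → kept (suc k)))
      ≈⟨ +-congˡ (trans (Σ-distrib-⊕ n (λ k → kept (suc k)) raised) (+-comm _ _)) ⟨
    kept 0 ⊕ Σ n (λ k → kept (suc k) ⊕ raised k)
      ≈⟨ +-congˡ (Σ-cong n (λ k → ×-homo-+ (g (suc k)) ((suc k + r) * c (suc k)) (c k))) ⟨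
    kept 0 ⊕ Σ n (λ k → shiftedRStirling2 r (suc n) (suc k) × g (suc k))
      ≈⟨ Σ-uncons n _ ⟨
    Σ (suc n) (λ k → shiftedRStirling2 r (suc n) k × g k)
      ∎
    where
    c : ℕ → ℕ
    c = shiftedRStirling2 r n
    raised kept : ℕ → Carrier
    raised k = c k × g (suc k)
    kept   k = ((k + r) * c k) × g k
    split : ∀ k → c k × (g (suc k) ⊕ (k + r) × g k) ≈ raised k ⊕ kept k
    split k = trans (×-distrib-+ (g (suc k)) _ (c k))
      (+-congˡ (trans (×-assocˡ (g k) (c k) (k + r)) (×-congˡ (ℕ.*-comm (c k) (k + r)))))
    last-vanishes : kept (suc n) ≈ 0#
    last-vanishes = ×-congˡ (≡.trans
      (≡.cong ((suc n + r) *_) (shiftedRStirling2-above r n (suc n) (ℕ.n<1+n n)))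
      (ℕ.*-zeroʳ (suc n + r)))

  module _ (A : ℕ → ℕ → Carrier) (recurrence : ∀ n m → A (suc n) m ≈ A n (suc m) ⊕ m × A n m) where

    Σ-stirling1-column0≈entry : ∀ m n → Σ m (λ k → stirling1 m k · A (n + k) 0) ≈ A n m
    Σ-stirling1-column0≈entry zero    n =
      trans (+-identityʳ _) (reflexive (≡.cong (λ i → A i 0) (ℕ.+-identityʳ n)))
    Σ-stirling1-column0≈entry (suc m) n = begin
      Σ (suc m) (λ k → stirling1 (suc m) k · A (n + k) 0)
        ≈⟨ Σ-stirling1-suc m (λ k → A (n + k) 0) ⟩
      Σ m (λ k → stirling1 m k · A (n + suc k) 0) - m × Σ m (λ k → stirling1 m k · A (n + k) 0)
        ≈⟨ +-cong (trans (Σ-cong m next-row) (Σ-stirling1-column0≈entry m (suc n)))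
                  (-‿cong (×-congʳ m (Σ-stirling1-column0≈entry m n))) ⟩
      A (suc n) m - m × A n m
        ≈⟨ +-congʳ (recurrence n m) ⟩
      (A n (suc m) ⊕ m × A n m) - m × A n m
        ≈⟨ //-rightDividesʳ (m × A n m) (A n (suc m)) ⟩
      A n (suc m)
        ∎
      where
      next-row : ∀ k → stirling1 m k · A (n + suc k) 0 ≈ stirling1 m k · A (suc n + k) 0
      next-row k = reflexive (≡.cong (λ i → stirling1 m k · A i 0) (ℕ.+-suc n k))

    entry≈Σ-shiftedRStirling2 : ∀ n p m → A (p + n) m ≈ Σ n (λ k → shiftedRStirling2 m n k × A p (m + k))
    entry≈Σ-shiftedRStirling2 zero    p m =
      trans (reflexive (≡.cong₂ A (ℕ.+-identityʳ p) (≡.sym (ℕ.+-identityʳ m)))) (sym (+-identityʳ _))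
    entry≈Σ-shiftedRStirling2 (suc n) p m = begin
      A (p + suc n) m
        ≡⟨ ≡.cong (λ i → A i m) (ℕ.+-suc p n) ⟩
      A (suc p + n) m
        ≈⟨ entry≈Σ-shiftedRStirling2 n (suc p) m ⟩
      Σ n (λ k → shiftedRStirling2 m n k × A (suc p) (m + k))
        ≈⟨ Σ-cong n (λ k → ×-congʳ (shiftedRStirling2 m n k) (unfold k)) ⟩
      Σ n (λ k → shiftedRStirling2 m n k × (A p (m + suc k) ⊕ (k + m) × A p (m + k)))
        ≈⟨ Σ-shiftedRStirling2-suc m n (λ k → A p (m + k)) ⟩
      Σ (suc n) (λ k → shiftedRStirling2 m (suc n) k × A p (m + k))
        ∎
      where
      unfold : ∀ k → A (suc p) (m + k) ≈ A p (m + suc k) ⊕ (k + m) × A p (m + k)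
      unfold k = trans (recurrence p (m + k))
        (+-cong (reflexive (≡.cong (A p) (≡.sym (ℕ.+-suc m k)))) (×-congˡ (ℕ.+-comm m k)))

corollary1 : ∀ {c ℓ} (R : CommutativeRing c ℓ) →
    let open CommutativeRing R renaming (_+_ to _⊕_) in
    (A : ℕ → ℕ → Carrier) →
    (∀ n m → A (suc n) m ≈ A n (suc m) ⊕ _·ℕ_ R m (A n m)) →
    ∀ n m →
    sumTo R m (λ k → _·ℤ_ R (stirling1 m k) (A (n + k) 0))
    ≈ sumTo R n (λ k → _·ℕ_ R (rStirling2 m (n + m) (k + m)) (A 0 (m + k)))
corollary1 R A hyp n m = begin
  sumTo R m (λ k → _·ℤ_ R (stirling1 m k) (A (n + k) 0))
    ≈⟨ Σ-stirling1-column0≈entry R A recurrence m n ⟩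
  A n m
    ≈⟨ entry≈Σ-shiftedRStirling2 R A recurrence n 0 m ⟩
  sumTo R n (λ k → shiftedRStirling2 m n k × A 0 (m + k))
    ≈⟨ Σ-cong R n coefficient ⟩
  sumTo R n (λ k → _·ℕ_ R (rStirling2 m (n + m) (k + m)) (A 0 (m + k)))
    ∎
  where
  open CommutativeRing R renaming (_+_ to _⊕_)
  open import Algebra.Properties.CommutativeMonoid.Mult +-commutativeMonoid using (_×_)
  open import Relation.Binary.Reasoning.Setoid setoid
  recurrence : ∀ n m → A (suc n) m ≈ A n (suc m) ⊕ m × A n m
  recurrence n m = trans (hyp n m) (+-congˡ (reflexive (·ℕ≡× R m (A n m))))
  coefficient : ∀ k → shiftedRStirling2 m n k × A 0 (m + k)
                      ≈ _·ℕ_ R (rStirling2 m (n + m) (k + m)) (A 0 (m + k))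
  coefficient k rewrite rStirling2≡shiftedRStirling2 m n k =
    reflexive (≡.sym (·ℕ≡× R (shiftedRStirling2 m n k) (A 0 (m + k))))
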